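{- Let $G$ be a graph and $\ell$ an integer such that $\frac{1}{2}(\mathsf{MM}(G) + \mathsf{IS}(G)) = \mathsf{IM}(G)$ and $G$ has an induced matching of size $\ell$. Let $(G', \ell')$ be the instance obtained from $(G,\ell)$ by exhaustively applying the following reduction rules: (R1) delete an isolated vertex; (R2) delete both endpoints of an isolated edge (two adjacent vertices both of degree 1) and decrease $\ell$ by one if $\ell > 0$; (R3) if $u,v,w$ are pairwise adjacent with $\deg(u) = \deg(w) = 2$, delete $v$. Then $\ell' = 0$.
   Context: All graphs are finite, simple and undirected. $\mathsf{MM}(G)$, $\mathsf{IS}(G)$, $\mathsf{IM}(G)$ denote the maximum size of a matching, of an independent set, and of an induced matching of $G$, respectively; a matching $M$ is induced if no edge of $G$ joins endpoints of two distinct edges of $M$. -}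

module Defs where

open import Data.Nat using (ℕ; zero; suc; _+_; _*_; _∸_)
open import Data.Bool using (Bool; true; false)
open import Data.Fin using (Fin)
open import Data.Fin.Subset using (Subset; _∈_; _∩_; _-_; ∣_∣)
open import Data.Vec using (tabulate)
open import Data.Product using (_×_; _,_; Σ; ∃; proj₁; proj₂)
open import Relation.Binary.PropositionalEquality using (_≡_; _≢_)
open import Relation.Nullary using (¬_)

record Graph (n : ℕ) : Set where
  field
    adj   : Fin n → Fin n → Bool
    sym   : ∀ u v → adj u v ≡ adj v u
    irrefl : ∀ v → adj v v ≡ false
open Graph public

Edge : ∀ {n} → Graph n → Fin n → Fin n → Set
Edge G u v = adj G u v ≡ true

_∼ₑ_ : ∀ {n} → Fin n → Fin n × Fin n → Set
x ∼ₑ (a , b) = (x ≡ a) Data.Sum.⊎ (x ≡ b)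
  where import Data.Sum

IsMatching : ∀ {n} (G : Graph n) {k} → (Fin k → Fin n × Fin n) → Set
IsMatching G {k} M =
  (∀ i → Edge G (proj₁ (M i)) (proj₂ (M i))) ×
  (∀ i j → i ≢ j → ∀ x → x ∼ₑ M i → ¬ (x ∼ₑ M j))

IsInducedMatching : ∀ {n} (G : Graph n) {k} → (Fin k → Fin n × Fin n) → Set
IsInducedMatching G {k} M =
  IsMatching G M ×
  (∀ i j → i ≢ j → ∀ x y → x ∼ₑ M i → y ∼ₑ M j → ¬ Edge G x y)

IsIndependentSet : ∀ {n} (G : Graph n) {k} → (Fin k → Fin n) → Set
IsIndependentSet G {k} I =
  (∀ i j → i ≢ j → I i ≢ I j) × (∀ i j → ¬ Edge G (I i) (I j))

HasMatching HasInducedMatching HasIndependentSet : ∀ {n} → Graph n → ℕ → Set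
HasMatching G k = Σ (Fin k → _) (IsMatching G)
HasInducedMatching G k = Σ (Fin k → _) (IsInducedMatching G)
HasIndependentSet G k = Σ (Fin k → _) (IsIndependentSet G)

IsMax : (ℕ → Set) → ℕ → Set
IsMax P m = P m × (∀ k → P k → k Data.Nat.≤ m)
  where import Data.Nat

IsMM IsIS IsIM : ∀ {n} → Graph n → ℕ → Set
IsMM G = IsMax (HasMatching G)
IsIS G = IsMax (HasIndependentSet G)
IsIM G = IsMax (HasInducedMatching G)

-- Reduction rules.  The current graph is the induced subgraph G[S] of the
-- original graph G on the set S of surviving vertices; an instance is a
-- pair (S , ℓ).

Instance : ℕ → Set
Instance n = Subset n × ℕ

deg : ∀ {n} → Graph n → Subset n → Fin n → ℕ
deg G S v = ∣ S ∩ tabulate (adj G v) ∣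

data Step {n} (G : Graph n) : Instance n → Instance n → Set where
  R1 : ∀ {S ℓ} v → v ∈ S → deg G S v ≡ 0 →
       Step G (S , ℓ) (S - v , ℓ)
  R2 : ∀ {S ℓ} u v → u ∈ S → v ∈ S → Edge G u v →
       deg G S u ≡ 1 → deg G S v ≡ 1 →
       Step G (S , ℓ) (S - u - v , ℓ ∸ 1)
  R3 : ∀ {S ℓ} u v w → u ∈ S → v ∈ S → w ∈ S →
       Edge G u v → Edge G v w → Edge G u w →
       deg G S u ≡ 2 → deg G S w ≡ 2 →
       Step G (S , ℓ) (S - v , ℓ)

Irreducible : ∀ {n} → Graph n → Instance n → Set
Irreducible G I = ∀ J → ¬ Step G I J

-- Call S tight of size k when G[S] has an induced matching of size k but no matching
-- and no independent set larger than k, i.e. IM = MM = IS = k on G[S].  Since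
-- IM ≤ MM and IM ≤ IS, the hypothesis MM + IS = 2 IM makes V(G) tight of size IM(G) ≥ ℓ.
-- The rules preserve tightness, (R2) lowering the size by one and the others keeping
-- it: the induced matching is repaired locally, and a matching or independent set of
-- the reduced graph extends by the deleted edge, resp. one of its ends.  An
-- irreducible tight instance has size 0.  Otherwise each edge of the induced matching M
-- has an end of degree 1: if both ends had neighbours outside V(M), two distinct such
-- neighbours would augment M and a single common one would let (R3) apply.  These ends
-- are independent, so no vertex lies outside V(M) (IS would be exceeded), and then
-- every edge of M is isolated, letting (R2) apply.
module Submission where

open import Defs
open import Data.Empty using (⊥; ⊥-elim)
open import Data.Fin using (Fin; zero; suc; punchIn) renaming (_≟_ to _≟ᶠ_)
open import Data.Fin.Properties using (punchInᵢ≢i; punchIn-injective; injective⇒≤; any?)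
open import Data.Fin.Subset using (Subset; ⊤; inside; outside; _∈_; _∉_; _⊆_; _-_; _∩_; ⁅_⁆; ∣_∣)
open import Data.Fin.Subset.Properties
  using (∈⊤; x∈p∩q⁺; x∈p∩q⁻; x∈p∧x≢y⇒x∈p-y; p─q⊆p; p─⊥≡p; Empty-unique; ∣⊥∣≡0)
open import Data.Nat using (ℕ; zero; suc; _+_; _*_; _≤_; _≟_)
open import Data.Nat.Properties
  using (suc-injective; ≤-trans; ≤-reflexive; ≤-pred; ≤∧≢⇒<; m<1+n⇒m≤n; n≤0⇒n≡0; 1+n≰n;
         +-identityʳ; +-comm; +-cancelʳ-≤; +-monoʳ-≤; ∸-monoˡ-≤)
open import Data.Product using (_×_; _,_; proj₁; proj₂; ∃; ∃-syntax)
open import Data.Sum using (_⊎_; inj₁; inj₂; [_,_]′; swap)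
open import Data.Vec as Vec using (here; there; tabulate)
open import Data.Vec.Functional using (_∷_; removeAt)
open import Data.Vec.Properties using ([]=⇒lookup; lookup⇒[]=; lookup∘tabulate)
open import Function using (_∘_; id)
open import Function.Definitions using (Injective)
open import Relation.Binary.Construct.Closure.ReflexiveTransitive using (Star; fold)
open import Relation.Binary.PropositionalEquality
  using (_≡_; _≢_; refl; trans; cong; subst) renaming (sym to ≡-sym)
open import Relation.Nullary using (¬_; Dec; yes; no)
open import Relation.Nullary.Decidable using (_⊎-dec_; decidable-stable; ¬¬-excluded-middle)

x∉p-x : ∀ {n} {x : Fin n} (p : Subset n) → x ∉ p - x
x∉p-x {x = zero}  (inside  Vec.∷ p) ()
x∉p-x {x = zero}  (outside Vec.∷ p) ()
x∉p-x {x = suc x} (_ Vec.∷ p) (there x∈p-x) = x∉p-x p x∈p-x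

x∈p-y⇒x∈p : ∀ {n} {x y : Fin n} (p : Subset n) → x ∈ p - y → x ∈ p
x∈p-y⇒x∈p {y = y} p = p─q⊆p p ⁅ y ⁆

x∈p-y⇒x≢y : ∀ {n} {x y : Fin n} (p : Subset n) → x ∈ p - y → x ≢ y
x∈p-y⇒x≢y p x∈p-x refl = x∉p-x p x∈p-x

∣p∣≡1+∣p-x∣ : ∀ {n} {x : Fin n} {p : Subset n} → x ∈ p → ∣ p ∣ ≡ suc ∣ p - x ∣
∣p∣≡1+∣p-x∣ {x = zero}  {inside  Vec.∷ p} here = cong suc (cong ∣_∣ (≡-sym (p─⊥≡p p)))
∣p∣≡1+∣p-x∣ {x = suc x} {inside  Vec.∷ p} (there x∈p) = cong suc (∣p∣≡1+∣p-x∣ x∈p)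
∣p∣≡1+∣p-x∣ {x = suc x} {outside Vec.∷ p} (there x∈p) = ∣p∣≡1+∣p-x∣ x∈p

∣p∣≡1+m⇒∣p-x∣≡m : ∀ {n m} {x : Fin n} {p : Subset n} → ∣ p ∣ ≡ suc m → x ∈ p → ∣ p - x ∣ ≡ m
∣p∣≡1+m⇒∣p-x∣≡m ∣p∣≡1+m x∈p = suc-injective (trans (≡-sym (∣p∣≡1+∣p-x∣ x∈p)) ∣p∣≡1+m)

∣p∣≡0⇒x∉p : ∀ {n} {x : Fin n} {p : Subset n} → ∣ p ∣ ≡ 0 → x ∉ p
∣p∣≡0⇒x∉p ∣p∣≡0 x∈p with () ← trans (≡-sym ∣p∣≡0) (∣p∣≡1+∣p-x∣ x∈p)

∀x∉p⇒∣p∣≡0 : ∀ {n} {p : Subset n} → (∀ x → x ∉ p) → ∣ p ∣ ≡ 0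
∀x∉p⇒∣p∣≡0 {n} none = trans (cong ∣_∣ (Empty-unique λ (x , x∈p) → none x x∈p)) (∣⊥∣≡0 n)

∣p∣≡1⇒x≡a : ∀ {n} {a x : Fin n} {p : Subset n} → ∣ p ∣ ≡ 1 → a ∈ p → x ∈ p → x ≡ a
∣p∣≡1⇒x≡a {a = a} {x} ∣p∣≡1 a∈p x∈p with x ≟ᶠ a
... | yes x≡a = x≡a
... | no  x≢a = ⊥-elim (∣p∣≡0⇒x∉p (∣p∣≡1+m⇒∣p-x∣≡m ∣p∣≡1 a∈p) (x∈p∧x≢y⇒x∈p-y x∈p x≢a))

∣p∣≡2⇒x≡a⊎x≡b : ∀ {n} {a b x : Fin n} {p : Subset n} →
                ∣ p ∣ ≡ 2 → a ∈ p → b ∈ p → b ≢ a → x ∈ p → x ≡ a ⊎ x ≡ b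
∣p∣≡2⇒x≡a⊎x≡b {a = a} {x = x} ∣p∣≡2 a∈p b∈p b≢a x∈p with x ≟ᶠ a
... | yes x≡a = inj₁ x≡a
... | no  x≢a = inj₂ (∣p∣≡1⇒x≡a (∣p∣≡1+m⇒∣p-x∣≡m ∣p∣≡2 a∈p)
                                 (x∈p∧x≢y⇒x∈p-y b∈p b≢a) (x∈p∧x≢y⇒x∈p-y x∈p x≢a))

x≡a⇒∣p∣≡1 : ∀ {n} {a : Fin n} {p : Subset n} → a ∈ p → (∀ {x} → x ∈ p → x ≡ a) → ∣ p ∣ ≡ 1
x≡a⇒∣p∣≡1 {p = p} a∈p only-a = trans (∣p∣≡1+∣p-x∣ a∈p) (cong suc (∀x∉p⇒∣p∣≡0 λ x x∈p-a →
  x∈p-y⇒x≢y p x∈p-a (only-a (x∈p-y⇒x∈p p x∈p-a))))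

x≡a⊎x≡b⇒∣p∣≡2 : ∀ {n} {a b : Fin n} {p : Subset n} →
                a ∈ p → b ∈ p → b ≢ a → (∀ {x} → x ∈ p → x ≡ a ⊎ x ≡ b) → ∣ p ∣ ≡ 2
x≡a⊎x≡b⇒∣p∣≡2 {p = p} a∈p b∈p b≢a only-ab = trans (∣p∣≡1+∣p-x∣ a∈p) (cong suc
  (x≡a⇒∣p∣≡1 (x∈p∧x≢y⇒x∈p-y b∈p b≢a) λ x∈p-a →
    [ ⊥-elim ∘ x∈p-y⇒x≢y p x∈p-a , id ]′ (only-ab (x∈p-y⇒x∈p p x∈p-a))))

distinct⇒injective : ∀ {m} {A : Set} {f : Fin m → A} →
                     (∀ i j → i ≢ j → f i ≢ f j) → Injective _≡_ _≡_ f
distinct⇒injective distinct {i} {j} fi≡fj with i ≟ᶠ j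
... | yes i≡j = i≡j
... | no  i≢j = ⊥-elim (distinct i j i≢j fi≡fj)

¬¬-max : ∀ (P : ℕ → Set) N → P 0 → (∀ k → P k → k ≤ N) → ¬ ¬ ∃ (IsMax P)
¬¬-max P zero    p0 bound no-max = no-max (0 , p0 , bound)
¬¬-max P (suc N) p0 bound no-max = ¬¬-excluded-middle λ
  { (yes p) → no-max (suc N , p , bound)
  ; (no ¬p) → ¬¬-max P N p0 (λ k pk → m<1+n⇒m≤n (≤∧≢⇒< (bound k pk) λ { refl → ¬p pk })) no-max
  }

+≡2*⇒≤ : ∀ {a b c} → a + b ≡ 2 * c → c ≤ b → a ≤ c
+≡2*⇒≤ {a} {b} {c} a+b≡2c c≤b = +-cancelʳ-≤ c a c
  (≤-trans (+-monoʳ-≤ a c≤b) (≤-reflexive (trans a+b≡2c (cong (c +_) (+-identityʳ c)))))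

module _ {n : ℕ} (G : Graph n) where

  Edge-sym : ∀ {x y} → Edge G x y → Edge G y x
  Edge-sym {x} {y} xy = trans (Graph.sym G y x) xy

  Edge-irrefl : ∀ {x} → ¬ Edge G x x
  Edge-irrefl {x} xx with () ← trans (≡-sym (irrefl G x)) xx

  Edge⇒≢ : ∀ {x y} → Edge G x y → x ≢ y
  Edge⇒≢ xy refl = Edge-irrefl xy

  -- deg G S x unfolds to ∣ Nbr S x ∣, so the cardinality lemmas above apply to degrees.
  Nbr : Subset n → Fin n → Subset n
  Nbr S x = S ∩ tabulate (adj G x)

  ∈Nbr⁺ : ∀ {S x y} → y ∈ S → Edge G x y → y ∈ Nbr S x
  ∈Nbr⁺ {x = x} {y} y∈S xy =
    x∈p∩q⁺ (y∈S , lookup⇒[]= y (tabulate (adj G x)) (trans (lookup∘tabulate (adj G x) y) xy))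

  ∈Nbr⁻ : ∀ {S x y} → y ∈ Nbr S x → y ∈ S × Edge G x y
  ∈Nbr⁻ {S} {x} {y} y∈N with x∈p∩q⁻ S (tabulate (adj G x)) y∈N
  ... | y∈S , y∈adj = y∈S , trans (≡-sym (lookup∘tabulate (adj G x) y)) ([]=⇒lookup y∈adj)

  Pair : Set
  Pair = Fin n × Fin n

  IsEdge : Pair → Set
  IsEdge e = Edge G (proj₁ e) (proj₂ e)

  _∼?_ : ∀ (x : Fin n) (e : Pair) → Dec (x ∼ₑ e)
  x ∼? e = (x ≟ᶠ proj₁ e) ⊎-dec (x ≟ᶠ proj₂ e)

  ≢⇒≁ : ∀ {x a b : Fin n} → x ≢ a → x ≢ b → ¬ x ∼ₑ (a , b)
  ≢⇒≁ x≢a x≢b = [ x≢a , x≢b ]′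

  partner : ∀ {e x} → IsEdge e → x ∼ₑ e → ∃[ y ] y ∼ₑ e × Edge G x y
  partner {e} ab (inj₁ refl) = proj₂ e , inj₂ refl , ab
  partner {e} ab (inj₂ refl) = proj₁ e , inj₁ refl , Edge-sym ab

  Meets : Pair → Pair → Set
  Meets e f = ∃[ z ] z ∼ₑ e × z ∼ₑ f

  Joined : Pair → Pair → Set
  Joined e f = ∃[ x ] ∃[ y ] x ∼ₑ e × y ∼ₑ f × Edge G x y

  ≁⇒¬Meets : ∀ {x y f} → ¬ x ∼ₑ f → ¬ y ∼ₑ f → ¬ Meets (x , y) f
  ≁⇒¬Meets x≁f _   (_ , inj₁ refl , x∼f) = x≁f x∼f
  ≁⇒¬Meets _   y≁f (_ , inj₂ refl , y∼f) = y≁f y∼f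

  ¬Edge⇒¬Joined : ∀ {x y f} → (∀ {z} → z ∼ₑ f → ¬ Edge G x z) → (∀ {z} → z ∼ₑ f → ¬ Edge G y z) →
                  ¬ Joined (x , y) f
  ¬Edge⇒¬Joined x-far _     (_ , _ , inj₁ refl , z∼f , xz) = x-far z∼f xz
  ¬Edge⇒¬Joined _     y-far (_ , _ , inj₂ refl , z∼f , yz) = y-far z∼f yz

  IsMatching-∷ : ∀ {k e} {M : Fin k → Pair} → IsMatching G M → IsEdge e → (∀ j → ¬ Meets e (M j)) →
                 IsMatching G (e ∷ M)
  IsMatching-∷ {e = e} {M} (edges , disjoint) e-edge e-apart = edges′ , disjoint′
    where
    edges′ : ∀ i → IsEdge ((e ∷ M) i)
    edges′ zero    = e-edge
    edges′ (suc i) = edges i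
    disjoint′ : ∀ i j → i ≢ j → ∀ z → z ∼ₑ (e ∷ M) i → ¬ z ∼ₑ (e ∷ M) j
    disjoint′ zero    zero    i≢j         = ⊥-elim (i≢j refl)
    disjoint′ zero    (suc j) _   z z∼e z∼Mj = e-apart j (z , z∼e , z∼Mj)
    disjoint′ (suc i) zero    _   z z∼Mi z∼e = e-apart i (z , z∼e , z∼Mi)
    disjoint′ (suc i) (suc j) i≢j         = disjoint i j (i≢j ∘ cong suc)

  IsInducedMatching-∷ : ∀ {k e} {M : Fin k → Pair} → IsInducedMatching G M → IsEdge e →
                        (∀ j → ¬ Meets e (M j)) → (∀ j → ¬ Joined e (M j)) →
                        IsInducedMatching G (e ∷ M)
  IsInducedMatching-∷ {e = e} {M} (matching , induced) e-edge e-apart e-far =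
    IsMatching-∷ matching e-edge e-apart , induced′
    where
    induced′ : ∀ i j → i ≢ j → ∀ x y → x ∼ₑ (e ∷ M) i → y ∼ₑ (e ∷ M) j → ¬ Edge G x y
    induced′ zero    zero    i≢j                 = ⊥-elim (i≢j refl)
    induced′ zero    (suc j) _   x y x∼e y∼Mj xy = e-far j (x , y , x∼e , y∼Mj , xy)
    induced′ (suc i) zero    _   x y x∼Mi y∼e xy = e-far i (y , x , y∼e , x∼Mi , Edge-sym xy)
    induced′ (suc i) (suc j) i≢j                 = induced i j (i≢j ∘ cong suc)

  IsMatching-∘ : ∀ {k m} {M : Fin k → Pair} {f : Fin m → Fin k} → Injective _≡_ _≡_ f →
                 IsMatching G M → IsMatching G (M ∘ f)
  IsMatching-∘ {f = f} f-inj (edges , disjoint) = edges ∘ f , λ i j i≢j → disjoint (f i) (f j) (i≢j ∘ f-inj)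

  IsInducedMatching-∘ : ∀ {k m} {M : Fin k → Pair} {f : Fin m → Fin k} → Injective _≡_ _≡_ f →
                        IsInducedMatching G M → IsInducedMatching G (M ∘ f)
  IsInducedMatching-∘ {f = f} f-inj (matching , induced) =
    IsMatching-∘ f-inj matching , λ i j i≢j → induced (f i) (f j) (i≢j ∘ f-inj)

  IsIndependentSet-∷ : ∀ {k v} {I : Fin k → Fin n} → IsIndependentSet G I →
                       (∀ i → v ≢ I i) → (∀ i → ¬ Edge G v (I i)) → IsIndependentSet G (v ∷ I)
  IsIndependentSet-∷ {v = v} {I} (distinct , independent) v-new v-far = distinct′ , independent′
    where
    distinct′ : ∀ i j → i ≢ j → (v ∷ I) i ≢ (v ∷ I) j
    distinct′ zero    zero    i≢j = ⊥-elim (i≢j refl)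
    distinct′ zero    (suc j) _   = v-new j
    distinct′ (suc i) zero    _   = v-new i ∘ ≡-sym
    distinct′ (suc i) (suc j) i≢j = distinct i j (i≢j ∘ cong suc)
    independent′ : ∀ i j → ¬ Edge G ((v ∷ I) i) ((v ∷ I) j)
    independent′ zero    zero    = Edge-irrefl
    independent′ zero    (suc j) = v-far j
    independent′ (suc i) zero    = v-far i ∘ Edge-sym
    independent′ (suc i) (suc j) = independent i j

  matching-size≤n : ∀ {k} → HasMatching G k → k ≤ n
  matching-size≤n (M , _ , disjoint) =
    injective⇒≤ (distinct⇒injective λ i j i≢j Mi≡Mj → disjoint i j i≢j _ (inj₁ refl) (inj₁ Mi≡Mj))

  independent-set-size≤n : ∀ {k} → HasIndependentSet G k → k ≤ n
  independent-set-size≤n (I , distinct , _) = injective⇒≤ (distinct⇒injective distinct)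

  ends⇒independent-set : ∀ {k} {M : Fin k → Pair} {c : Fin k → Fin n} → IsInducedMatching G M →
                         (∀ i → c i ∼ₑ M i) → IsIndependentSet G c
  ends⇒independent-set {M = M} {c} ((_ , disjoint) , induced) c∼M = distinct , independent
    where
    distinct : ∀ i j → i ≢ j → c i ≢ c j
    distinct i j i≢j ci≡cj = disjoint i j i≢j (c i) (c∼M i) (subst (_∼ₑ M j) (≡-sym ci≡cj) (c∼M j))
    independent : ∀ i j → ¬ Edge G (c i) (c j)
    independent i j with i ≟ᶠ j
    ... | yes refl = Edge-irrefl
    ... | no  i≢j  = induced i j i≢j (c i) (c j) (c∼M i) (c∼M j)

  induced-matching⇒independent-set : ∀ {k} → HasInducedMatching G k → HasIndependentSet G k
  induced-matching⇒independent-set (M , induced) = proj₁ ∘ M , ends⇒independent-set induced λ _ → inj₁ refl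

  EndsIn : Subset n → ∀ {k} → (Fin k → Pair) → Set
  EndsIn S M = ∀ i z → z ∼ₑ M i → z ∈ S

  MatchingsIn≤ IndependentSetsIn≤ : Subset n → ℕ → Set
  MatchingsIn≤ S k = ∀ {m} {M : Fin m → Pair} → IsMatching G M → EndsIn S M → m ≤ k
  IndependentSetsIn≤ S k = ∀ {m} {I : Fin m → Fin n} → IsIndependentSet G I → (∀ i → I i ∈ S) → m ≤ k

  record Tight (S : Subset n) (k : ℕ) : Set where
    field
      M            : Fin k → Pair
      induced      : IsInducedMatching G M
      ends∈S       : EndsIn S M
      matchings≤   : MatchingsIn≤ S k
      independent≤ : IndependentSetsIn≤ S k

    edges : ∀ i → IsEdge (M i)
    edges = proj₁ (proj₁ induced)

    disjoint : ∀ i j → i ≢ j → ∀ z → z ∼ₑ M i → ¬ z ∼ₑ M j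
    disjoint = proj₂ (proj₁ induced)

  Tight-⊆ : ∀ {S S′ k} → S′ ⊆ S → (M′ : Fin k → Pair) → IsInducedMatching G M′ → EndsIn S′ M′ →
            Tight S k → Tight S′ k
  Tight-⊆ S′⊆S M′ induced′ ends′ t = record
    { M            = M′
    ; induced      = induced′
    ; ends∈S       = ends′
    ; matchings≤   = λ matching ends → matchings≤ matching λ i z z∼Mi → S′⊆S (ends i z z∼Mi)
    ; independent≤ = λ independent ends → independent≤ independent (S′⊆S ∘ ends)
    }
    where open Tight t

  Tight-delete-unmatched : ∀ {S v k} (t : Tight S k) → (∀ i → ¬ v ∼ₑ Tight.M t i) → Tight (S - v) k
  Tight-delete-unmatched {S} {v} t v-free = Tight-⊆ (p─q⊆p S ⁅ v ⁆) M induced ends′ t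
    where
    open Tight t
    ends′ : EndsIn (S - v) M
    ends′ i z z∼Mi = x∈p∧x≢y⇒x∈p-y (ends∈S i z z∼Mi) λ { refl → v-free i z∼Mi }

  Tight-R1 : ∀ {S v k} → deg G S v ≡ 0 → Tight S k → Tight (S - v) k
  Tight-R1 deg≡0 t = Tight-delete-unmatched t λ i v∼Mi →
    let (y , y∼Mi , vy) = partner (edges i) v∼Mi in ∣p∣≡0⇒x∉p deg≡0 (∈Nbr⁺ (ends∈S i y y∼Mi) vy)
    where open Tight t

  ¬Tight-0 : ∀ {S u v} → u ∈ S → v ∈ S → Edge G u v → ¬ Tight S 0
  ¬Tight-0 {S} {u} {v} u∈S v∈S uv t =
    1+n≰n (matchings≤ (IsMatching-∷ {M = λ ()} ((λ ()) , (λ ())) uv (λ ())) ends)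
    where
    open Tight t
    ends : EndsIn S ((u , v) ∷ λ ())
    ends zero _ (inj₁ refl) = u∈S
    ends zero _ (inj₂ refl) = v∈S

  only-nbr-is-partner : ∀ {S k x u} {M : Fin k → Pair} → (∀ i → IsEdge (M i)) → EndsIn S M →
                        (∀ {y} → y ∈ Nbr S x → y ≡ u) → ∀ {j} → x ∼ₑ M j → u ∼ₑ M j
  only-nbr-is-partner edges ends only-u {j} x∼Mj with partner (edges j) x∼Mj
  ... | y , y∼Mj , xy with only-u (∈Nbr⁺ (ends j y y∼Mj) xy)
  ...   | refl = y∼Mj

  Tight-R2 : ∀ {S u v k} → u ∈ S → v ∈ S → Edge G u v → deg G S u ≡ 1 → deg G S v ≡ 1 →
             Tight S (suc k) → Tight (S - u - v) k
  Tight-R2 {S} {u} {v} {k} u∈S v∈S uv deg-u deg-v t = record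
    { M            = removeAt M i₀
    ; induced      = IsInducedMatching-∘ (punchIn-injective i₀ _ _) induced
    ; ends∈S       = ends′
    ; matchings≤   = matchings′
    ; independent≤ = independent′
    }
    where
    open Tight t

    ∈S : ∀ {x} → x ∈ S - u - v → x ∈ S
    ∈S = x∈p-y⇒x∈p S ∘ x∈p-y⇒x∈p (S - u)
    ≢u : ∀ {x} → x ∈ S - u - v → x ≢ u
    ≢u = x∈p-y⇒x≢y S ∘ x∈p-y⇒x∈p (S - u)
    ≢v : ∀ {x} → x ∈ S - u - v → x ≢ v
    ≢v = x∈p-y⇒x≢y (S - u)

    only-v : ∀ {y} → y ∈ Nbr S u → y ≡ v
    only-v = ∣p∣≡1⇒x≡a deg-u (∈Nbr⁺ v∈S uv)
    only-u : ∀ {y} → y ∈ Nbr S v → y ≡ u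
    only-u = ∣p∣≡1⇒x≡a deg-v (∈Nbr⁺ u∈S (Edge-sym uv))

    -- An edge of M through v also passes through u, so dropping the edge through u
    -- (or any edge if there is none) leaves a matching avoiding both.
    edge-at-u : ∃[ i ] ∀ j → j ≢ i → ¬ u ∼ₑ M j
    edge-at-u with any? (λ i → u ∼? M i)
    ... | yes (i , u∼Mi) = i , λ j j≢i u∼Mj → disjoint j i j≢i u u∼Mj u∼Mi
    ... | no  u-free     = zero , λ j _ u∼Mj → u-free (j , u∼Mj)

    i₀ : Fin (suc k)
    i₀ = proj₁ edge-at-u

    ends′ : EndsIn (S - u - v) (removeAt M i₀)
    ends′ j z z∼Mj = x∈p∧x≢y⇒x∈p-y (x∈p∧x≢y⇒x∈p-y (ends∈S _ z z∼Mj) z≢u) z≢v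
      where
      u≁ : ¬ u ∼ₑ M (punchIn i₀ j)
      u≁ = proj₂ edge-at-u (punchIn i₀ j) (punchInᵢ≢i i₀ j)
      z≢u : z ≢ u
      z≢u refl = u≁ z∼Mj
      z≢v : z ≢ v
      z≢v refl = u≁ (only-nbr-is-partner edges ends∈S only-u z∼Mj)

    matchings′ : MatchingsIn≤ (S - u - v) k
    matchings′ {M = M′} matching ends = ≤-pred (matchings≤ (IsMatching-∷ matching uv apart) ends″)
      where
      apart : ∀ j → ¬ Meets (u , v) (M′ j)
      apart j = ≁⇒¬Meets (λ u∼Mj → ≢u (ends j u u∼Mj) refl) (λ v∼Mj → ≢v (ends j v v∼Mj) refl)
      ends″ : EndsIn S ((u , v) ∷ M′)
      ends″ zero    _ (inj₁ refl) = u∈S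
      ends″ zero    _ (inj₂ refl) = v∈S
      ends″ (suc j) z z∼Mj        = ∈S (ends j z z∼Mj)

    independent′ : IndependentSetsIn≤ (S - u - v) k
    independent′ {I = I} independent ins =
      ≤-pred (independent≤ (IsIndependentSet-∷ independent u-new u-far) ins′)
      where
      u-new : ∀ i → u ≢ I i
      u-new i u≡Ii = ≢u (ins i) (≡-sym u≡Ii)
      u-far : ∀ i → ¬ Edge G u (I i)
      u-far i uIi = ≢v (ins i) (only-v (∈Nbr⁺ (∈S (ins i)) uIi))
      ins′ : ∀ i → (u ∷ I) i ∈ S
      ins′ zero    = u∈S
      ins′ (suc i) = ∈S (ins i)

  Tight-R3-matched : ∀ {S u v w k} → u ∈ S → v ∈ S → w ∈ S → Edge G u v → Edge G v w → Edge G u w →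
                     deg G S u ≡ 2 → deg G S w ≡ 2 → (t : Tight S k) → ∀ i → v ∼ₑ Tight.M t i →
                     Tight (S - v) k
  Tight-R3-matched {k = zero} _ _ _ _ _ _ _ _ _ () _
  Tight-R3-matched {S} {u} {v} {w} {suc k} u∈S v∈S w∈S uv vw uw deg-u deg-w t i v∼Mi =
    Tight-⊆ (p─q⊆p S ⁅ v ⁆) ((u , w) ∷ removeAt M i) induced′ ends′ t
    where
    open Tight t

    nbrs-u : ∀ {y} → y ∈ Nbr S u → y ≡ v ⊎ y ≡ w
    nbrs-u = ∣p∣≡2⇒x≡a⊎x≡b deg-u (∈Nbr⁺ v∈S uv) (∈Nbr⁺ w∈S uw) (Edge⇒≢ vw ∘ ≡-sym)
    nbrs-w : ∀ {y} → y ∈ Nbr S w → y ≡ v ⊎ y ≡ u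
    nbrs-w = ∣p∣≡2⇒x≡a⊎x≡b deg-w (∈Nbr⁺ v∈S (Edge-sym vw)) (∈Nbr⁺ u∈S (Edge-sym uw)) (Edge⇒≢ uv)

    v≁ : ∀ j {z} → z ∼ₑ removeAt M i j → z ≢ v
    v≁ j z∼Mj refl = disjoint _ i (punchInᵢ≢i i j) _ z∼Mj v∼Mi
    u≁ : ∀ j → ¬ u ∼ₑ removeAt M i j
    u≁ j u∼Mj = proj₂ induced _ i (punchInᵢ≢i i j) u v u∼Mj v∼Mi uv
    w≁ : ∀ j → ¬ w ∼ₑ removeAt M i j
    w≁ j w∼Mj = proj₂ induced _ i (punchInᵢ≢i i j) w v w∼Mj v∼Mi (Edge-sym vw)

    far : ∀ j → ¬ Joined (u , w) (removeAt M i j)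
    far j = ¬Edge⇒¬Joined
      (λ z∼Mj uz → [ v≁ j z∼Mj , (λ { refl → w≁ j z∼Mj }) ]′ (nbrs-u (∈Nbr⁺ (ends∈S _ _ z∼Mj) uz)))
      (λ z∼Mj wz → [ v≁ j z∼Mj , (λ { refl → u≁ j z∼Mj }) ]′ (nbrs-w (∈Nbr⁺ (ends∈S _ _ z∼Mj) wz)))

    induced′ : IsInducedMatching G ((u , w) ∷ removeAt M i)
    induced′ = IsInducedMatching-∷ (IsInducedMatching-∘ (punchIn-injective i _ _) induced) uw
                                   (λ j → ≁⇒¬Meets (u≁ j) (w≁ j)) far

    ends′ : EndsIn (S - v) ((u , w) ∷ removeAt M i)
    ends′ zero    _ (inj₁ refl) = x∈p∧x≢y⇒x∈p-y u∈S (Edge⇒≢ uv)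
    ends′ zero    _ (inj₂ refl) = x∈p∧x≢y⇒x∈p-y w∈S (Edge⇒≢ vw ∘ ≡-sym)
    ends′ (suc j) z z∼Mj        = x∈p∧x≢y⇒x∈p-y (ends∈S _ z z∼Mj) (v≁ j z∼Mj)

  Tight-R3 : ∀ {S u v w k} → u ∈ S → v ∈ S → w ∈ S → Edge G u v → Edge G v w → Edge G u w →
             deg G S u ≡ 2 → deg G S w ≡ 2 → Tight S k → Tight (S - v) k
  Tight-R3 {v = v} u∈S v∈S w∈S uv vw uw deg-u deg-w t with any? (λ i → v ∼? Tight.M t i)
  ... | yes (i , v∼Mi) = Tight-R3-matched u∈S v∈S w∈S uv vw uw deg-u deg-w t i v∼Mi
  ... | no  v-free     = Tight-delete-unmatched t λ i v∼Mi → v-free (i , v∼Mi)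

  module _ {S ℓ k} (irreducible : Irreducible G (S , ℓ)) (t : Tight S (suc k)) where
    open Tight t

    Unmatched : Fin n → Set
    Unmatched y = y ∈ S × (∀ j → ¬ y ∼ₑ M j)

    -- An unordered view of the edges of M, so that each argument is made once for both ends.
    Ends : Fin (suc k) → Fin n → Fin n → Set
    Ends i x y = M i ≡ (x , y) ⊎ M i ≡ (y , x)

    Ends-flip : ∀ {i x y} → Ends i x y → Ends i y x
    Ends-flip = swap

    Ends⇒∼ : ∀ {i x y} → Ends i x y → x ∼ₑ M i
    Ends⇒∼ (inj₁ refl) = inj₁ refl
    Ends⇒∼ (inj₂ refl) = inj₂ refl

    Ends⇒Edge : ∀ {i x y} → Ends i x y → Edge G x y
    Ends⇒Edge {i} (inj₁ refl) = edges i
    Ends⇒Edge {i} (inj₂ refl) = Edge-sym (edges i)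

    Ends⇒∈S : ∀ {i x y} → Ends i x y → x ∈ S
    Ends⇒∈S {i} e = ends∈S i _ (Ends⇒∼ e)

    ∼⇒≡⊎≡ : ∀ {i x y z} → Ends i x y → z ∼ₑ M i → z ≡ x ⊎ z ≡ y
    ∼⇒≡⊎≡ (inj₁ refl) z∼Mi = z∼Mi
    ∼⇒≡⊎≡ (inj₂ refl) z∼Mi = swap z∼Mi

    nbr-of-end : ∀ {i x y z} → Ends i x y → z ∈ Nbr S x → z ≡ y ⊎ Unmatched z
    nbr-of-end {i} {x} {z = z} e z∈N with ∈Nbr⁻ z∈N | any? (λ j → z ∼? M j)
    ... | z∈S , _  | no  z-free      = inj₂ (z∈S , λ j z∼Mj → z-free (j , z∼Mj))
    ... | _   , xz | yes (j , z∼Mj) with j ≟ᶠ i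
    ...   | no  j≢i = ⊥-elim (proj₂ induced i j (j≢i ∘ ≡-sym) x z (Ends⇒∼ e) z∼Mj xz)
    ...   | yes refl with ∼⇒≡⊎≡ e z∼Mj
    ...     | inj₁ refl = ⊥-elim (Edge-irrefl xz)
    ...     | inj₂ z≡y  = inj₁ z≡y

    no-unmatched-nbr⇒deg≡1 : ∀ {i x y} → Ends i x y → (∀ {v} → Unmatched v → ¬ Edge G x v) →
                             deg G S x ≡ 1
    no-unmatched-nbr⇒deg≡1 e x-closed = x≡a⇒∣p∣≡1 (∈Nbr⁺ (Ends⇒∈S (Ends-flip e)) (Ends⇒Edge e)) λ z∈N →
      [ id , (λ z-free → ⊥-elim (x-closed z-free (proj₂ (∈Nbr⁻ z∈N)))) ]′ (nbr-of-end e z∈N)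

    -- Otherwise M augments along the path v x y w.
    unmatched-nbrs-coincide : ∀ {i x y v w} → Ends i x y → Unmatched v → Unmatched w →
                              Edge G x v → Edge G y w → v ≡ w
    unmatched-nbrs-coincide {i} {x} {y} {v} {w} e (v∈S , v-free) (w∈S , w-free) xv yw with v ≟ᶠ w
    ... | yes v≡w = v≡w
    ... | no  v≢w = ⊥-elim (1+n≰n (matchings≤ augmented ends′))
      where
      rest : Fin k → Pair
      rest = removeAt M i
      x≁ : ∀ j → ¬ x ∼ₑ rest j
      x≁ j x∼Mj = disjoint _ i (punchInᵢ≢i i j) x x∼Mj (Ends⇒∼ e)
      y≁ : ∀ j → ¬ y ∼ₑ rest j
      y≁ j y∼Mj = disjoint _ i (punchInᵢ≢i i j) y y∼Mj (Ends⇒∼ (Ends-flip e))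
      apart : ∀ j → ¬ Meets (x , v) (((y , w) ∷ rest) j)
      apart zero    = ≁⇒¬Meets (≢⇒≁ (Edge⇒≢ (Ends⇒Edge e)) λ { refl → w-free i (Ends⇒∼ e) })
                               (≢⇒≁ (λ { refl → v-free i (Ends⇒∼ (Ends-flip e)) }) v≢w)
      apart (suc j) = ≁⇒¬Meets (x≁ j) (v-free _)
      augmented : IsMatching G ((x , v) ∷ (y , w) ∷ rest)
      augmented = IsMatching-∷ (IsMatching-∷ (IsMatching-∘ (punchIn-injective i _ _) (proj₁ induced)) yw
                                             λ j → ≁⇒¬Meets (y≁ j) (w-free _))
                               xv apart
      ends′ : EndsIn S ((x , v) ∷ (y , w) ∷ rest)
      ends′ zero          _ (inj₁ refl) = Ends⇒∈S e
      ends′ zero          _ (inj₂ refl) = v∈S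
      ends′ (suc zero)    _ (inj₁ refl) = Ends⇒∈S (Ends-flip e)
      ends′ (suc zero)    _ (inj₂ refl) = w∈S
      ends′ (suc (suc j)) z z∼Mj        = ends∈S _ z z∼Mj

    unique-unmatched-nbr⇒deg≡2 : ∀ {i x y v} → Ends i x y → Unmatched v → Edge G x v →
                                 (∀ {z} → Unmatched z → Edge G x z → z ≡ v) → deg G S x ≡ 2
    unique-unmatched-nbr⇒deg≡2 {i} e (v∈S , v-free) xv only-v =
      x≡a⊎x≡b⇒∣p∣≡2 (∈Nbr⁺ (Ends⇒∈S (Ends-flip e)) (Ends⇒Edge e)) (∈Nbr⁺ v∈S xv)
                    (λ { refl → v-free i (Ends⇒∼ (Ends-flip e)) })
                    λ z∈N → [ inj₁ , (λ z-free → inj₂ (only-v z-free (proj₂ (∈Nbr⁻ z∈N)))) ]′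
                            (nbr-of-end e z∈N)

    ¬common-unmatched-nbr : ∀ {i x y v} → Ends i x y → Unmatched v → Edge G x v → Edge G y v → ⊥
    ¬common-unmatched-nbr {x = x} {y} {v} e v-unmatched xv yv = irreducible _
      (R3 x v y (Ends⇒∈S e) (proj₁ v-unmatched) (Ends⇒∈S (Ends-flip e)) xv (Edge-sym yv) (Ends⇒Edge e)
          (unique-unmatched-nbr⇒deg≡2 e v-unmatched xv λ z-unmatched xz →
             unmatched-nbrs-coincide e z-unmatched v-unmatched xz yv)
          (unique-unmatched-nbr⇒deg≡2 (Ends-flip e) v-unmatched yv λ z-unmatched yz →
             unmatched-nbrs-coincide (Ends-flip e) z-unmatched v-unmatched yz xv))

    end-of-deg≡1 : ∀ i → ∃[ x ] ∃[ y ] Ends i x y × deg G S x ≡ 1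
    end-of-deg≡1 i with deg G S (proj₁ (M i)) ≟ 1 | deg G S (proj₂ (M i)) ≟ 1
    ... | yes deg≡1 | _         = _ , _ , inj₁ refl , deg≡1
    ... | no  _     | yes deg≡1 = _ , _ , inj₂ refl , deg≡1
    ... | no  deg≢1 | no  deg′≢1 =
      ⊥-elim (deg≢1 (no-unmatched-nbr⇒deg≡1 e λ v-unmatched xv →
              deg′≢1 (no-unmatched-nbr⇒deg≡1 (Ends-flip e) λ w-unmatched yw →
              ¬common-unmatched-nbr e v-unmatched xv
                (subst (Edge G _) (≡-sym (unmatched-nbrs-coincide e v-unmatched w-unmatched xv yw)) yw))))
      where
      e : Ends i (proj₁ (M i)) (proj₂ (M i))
      e = inj₁ refl

    leaf : Fin (suc k) → Fin n
    leaf i = proj₁ (end-of-deg≡1 i)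

    stem : Fin (suc k) → Fin n
    stem i = proj₁ (proj₂ (end-of-deg≡1 i))

    leaf-Ends : ∀ i → Ends i (leaf i) (stem i)
    leaf-Ends i = proj₁ (proj₂ (proj₂ (end-of-deg≡1 i)))

    leaf-deg≡1 : ∀ i → deg G S (leaf i) ≡ 1
    leaf-deg≡1 i = proj₂ (proj₂ (proj₂ (end-of-deg≡1 i)))

    ¬Unmatched : ∀ {r} → ¬ Unmatched r
    ¬Unmatched {r} (r∈S , r-free) =
      1+n≰n (independent≤ (IsIndependentSet-∷ leaves-independent r-new r-far) ins)
      where
      leaves-independent : IsIndependentSet G leaf
      leaves-independent = ends⇒independent-set induced (Ends⇒∼ ∘ leaf-Ends)
      r-new : ∀ i → r ≢ leaf i
      r-new i r≡leaf = r-free i (subst (_∼ₑ M i) (≡-sym r≡leaf) (Ends⇒∼ (leaf-Ends i)))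
      r-far : ∀ i → ¬ Edge G r (leaf i)
      r-far i r-leaf = r-free i (subst (_∼ₑ M i) (≡-sym r≡stem) (Ends⇒∼ (Ends-flip (leaf-Ends i))))
        where
        r≡stem : r ≡ stem i
        r≡stem = ∣p∣≡1⇒x≡a (leaf-deg≡1 i)
                   (∈Nbr⁺ (Ends⇒∈S (Ends-flip (leaf-Ends i))) (Ends⇒Edge (leaf-Ends i)))
                   (∈Nbr⁺ r∈S (Edge-sym r-leaf))
      ins : ∀ i → (r ∷ leaf) i ∈ S
      ins zero    = r∈S
      ins (suc i) = Ends⇒∈S (leaf-Ends i)

    irreducible⇒¬Tight : ⊥
    irreducible⇒¬Tight = irreducible _ (R2 _ _ (Ends⇒∈S e) (Ends⇒∈S (Ends-flip e)) (Ends⇒Edge e)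
      (no-unmatched-nbr⇒deg≡1 e λ unmatched _ → ¬Unmatched unmatched)
      (no-unmatched-nbr⇒deg≡1 (Ends-flip e) λ unmatched _ → ¬Unmatched unmatched))
      where
      e : Ends zero (proj₁ (M zero)) (proj₂ (M zero))
      e = inj₁ refl

  irreducible-Tight⇒0 : ∀ {S ℓ k} → Irreducible G (S , ℓ) → Tight S k → k ≡ 0
  irreducible-Tight⇒0 {k = zero}  _           _ = refl
  irreducible-Tight⇒0 {k = suc k} irreducible t = ⊥-elim (irreducible⇒¬Tight irreducible t)

  TightInstance : Instance n → Set
  TightInstance (S , ℓ) = ∃[ k ] ℓ ≤ k × Tight S k

  Step-preserves-Tight : ∀ {I J} → Step G I J → TightInstance I → TightInstance J
  Step-preserves-Tight (R1 v _ deg≡0) (k , ℓ≤k , t) = k , ℓ≤k , Tight-R1 deg≡0 t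
  Step-preserves-Tight (R2 u v u∈S v∈S uv _ _) (zero , _ , t) = ⊥-elim (¬Tight-0 u∈S v∈S uv t)
  Step-preserves-Tight (R2 u v u∈S v∈S uv deg-u deg-v) (suc k , ℓ≤k , t) =
    k , ∸-monoˡ-≤ 1 ℓ≤k , Tight-R2 u∈S v∈S uv deg-u deg-v t
  Step-preserves-Tight (R3 u v w u∈S v∈S w∈S uv vw uw deg-u deg-w) (k , ℓ≤k , t) =
    k , ℓ≤k , Tight-R3 u∈S v∈S w∈S uv vw uw deg-u deg-w t

  Star-preserves-Tight : ∀ {I J} → Star (Step G) I J → TightInstance I → TightInstance J
  Star-preserves-Tight =
    fold (λ I J → TightInstance I → TightInstance J) (λ step rest → rest ∘ Step-preserves-Tight step) id

  balanced⇒Tight : ∀ {mm is im} → IsMM G mm → IsIS G is → IsIM G im → mm + is ≡ 2 * im → Tight ⊤ im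
  balanced⇒Tight {mm} {is} {im} (_ , mm-max) (_ , is-max) ((M , induced) , _) balanced = record
    { M            = M
    ; induced      = induced
    ; ends∈S       = λ _ _ _ → ∈⊤
    ; matchings≤   = λ {m} {M′} matching _ → ≤-trans (mm-max m (M′ , matching)) mm≤im
    ; independent≤ = λ {m} {I} independent _ → ≤-trans (is-max m (I , independent)) is≤im
    }
    where
    im≤mm : im ≤ mm
    im≤mm = mm-max im (M , proj₁ induced)
    im≤is : im ≤ is
    im≤is = is-max im (induced-matching⇒independent-set (M , induced))
    mm≤im : mm ≤ im
    mm≤im = +≡2*⇒≤ balanced im≤is
    is≤im : is ≤ im
    is≤im = +≡2*⇒≤ (trans (+-comm is mm) balanced) im≤mm

lemma22 : ∀ {n} (G : Graph n) (ℓ : ℕ) →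
    (∀ mm is im → IsMM G mm → IsIS G is → IsIM G im → mm + is ≡ 2 * im) →
    HasInducedMatching G ℓ →
    ∀ (S' : Subset n) (ℓ' : ℕ) →
    Star (Step G) (⊤ , ℓ) (S' , ℓ') →
    Irreducible G (S' , ℓ') →
    ℓ' ≡ 0
lemma22 {n} G ℓ balanced has-ℓ S' ℓ' steps irreducible = decidable-stable (ℓ' ≟ 0) λ ℓ'≢0 →
  ¬¬-max (HasMatching G) n ((λ ()) , (λ ()) , (λ ())) (λ _ → matching-size≤n G) λ (mm , mm-max) →
  ¬¬-max (HasIndependentSet G) n ((λ ()) , (λ ()) , (λ ())) (λ _ → independent-set-size≤n G) λ (is , is-max) →
  ¬¬-max (HasInducedMatching G) n ((λ ()) , ((λ ()) , (λ ())) , (λ ()))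
         (λ _ (M , induced) → matching-size≤n G (M , proj₁ induced)) λ (im , im-max) →
  let tight = balanced⇒Tight G mm-max is-max im-max (balanced mm is im mm-max is-max im-max)
      (k , ℓ'≤k , t) = Star-preserves-Tight G steps (im , proj₂ im-max ℓ has-ℓ , tight)
  in ℓ'≢0 (n≤0⇒n≡0 (subst (ℓ' ≤_) (irreducible-Tight⇒0 G irreducible t) ℓ'≤k))
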